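{- Let $k\ge2$ be an integer and $q=p^r$ with $p$ prime and $r\ge1$. For $n\ge k$ let $T_{2,3,\dots,k}(n)=\sum_{i=1}^{n-k+1}X_iX_{i+1}\cdots X_{i+k-1}\in\mathbb{F}_q[X_1,\dots,X_n]$. Then the sequence $\{S_{\mathbb{F}_q}(T_{2,3,\dots,k}(n))\}_{n=k}^{\infty}$ satisfies a homogeneous linear recurrence with integer coefficients whose characteristic polynomial is $$Q_{T,k,\mathbb{F}_q}(X)=X^k-q\sum_{l=0}^{k-2}(q-1)^lX^{k-2-l}.$$
   Context: For $F\in\mathbb{F}_q[X_1,\dots,X_n]$, $S_{\mathbb{F}_q}(F)=\sum_{\mathbf{x}\in\mathbb{F}_q^n}e^{\frac{2\pi i}{p}\mathrm{Tr}_{\mathbb{F}_q/\mathbb{F}_p}(F(\mathbf{x}))}$, with $\mathrm{Tr}_{\mathbb{F}_q/\mathbb{F}_p}$ the field trace. A sequence satisfies the homogeneous linear recurrence with characteristic polynomial $X^d-\sum_{i=1}^d c_iX^{d-i}$ if $a_n=\sum_{i=1}^d c_ia_{n-i}$ for all admissible $n$. -}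

module Defs where

open import Level using (0ℓ)
open import Data.Nat as ℕ using (ℕ; zero; suc; _∸_)
open import Data.Integer as ℤ using (ℤ)
open import Data.Fin using (Fin; toℕ)
open import Data.List using (List; []; _∷_; map; concatMap; filter; length; take; drop; upTo; foldr)
open import Data.List.Membership.Propositional using (_∈_)
open import Data.List.Relation.Unary.Unique.Propositional using (Unique)
open import Data.Product using (∃)
open import Relation.Binary.PropositionalEquality using (_≡_; _≢_)
open import Relation.Binary.Definitions using (DecidableEquality)
open import Algebra.Structures using (IsCommutativeRing)

record FiniteField : Set₁ where
  infixl 6 _+_
  infixl 7 _*_
  field
    Carrier  : Set
    _+_ _*_  : Carrier → Carrier → Carrier
    -_       : Carrier → Carrier
    0# 1#    : Carrier
    isCommutativeRing : IsCommutativeRing _≡_ _+_ _*_ -_ 0# 1#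
    0≢1      : 0# ≢ 1#
    inverse  : ∀ x → x ≢ 0# → ∃ λ y → x * y ≡ 1#
    _≟_      : DecidableEquality Carrier
    elements : List Carrier
    complete : ∀ x → x ∈ elements
    unique   : Unique elements

module _ (F : FiniteField) where
  open FiniteField F

  fsum : List Carrier → Carrier
  fsum = foldr _+_ 0#

  fprod : List Carrier → Carrier
  fprod = foldr _*_ 1#

  fpow : Carrier → ℕ → Carrier
  fpow x zero    = 1#
  fpow x (suc m) = x * fpow x m

  -- m · 1  (the image of m ∈ ℕ in F); restricted to Fin p this is the
  -- canonical identification of ℤ/p with the prime field F_p
  natF : ℕ → Carrier
  natF zero    = 0#
  natF (suc m) = 1# + natF m

  trace : (p r : ℕ) → Carrier → Carrier
  trace p r x = fsum (map (λ j → fpow x (p ℕ.^ j)) (upTo r))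

  -- T_{2,...,k}(n) evaluated at (x_1,...,x_n) (given as a list of length n):
  -- Σ_{i=1}^{n-k+1} x_i x_{i+1} ... x_{i+k-1}   (0-indexed windows below)
  evalT : ℕ → List Carrier → Carrier
  evalT k xs = fsum (map (λ i → fprod (take k (drop i xs))) (upTo (suc (length xs ∸ k))))

  points : ℕ → List (List Carrier)
  points zero    = [] ∷ []
  points (suc n) = concatMap (λ x → map (x ∷_) (points n)) elements

  -- The exponential sum S_{F_q}(T_{2..k}(n)) = Σ_x ζ_p^{Tr(T(x))}, as an
  -- element of ℤ[ζ_p] ⊂ ℂ.  An element of ℤ[ζ_p] is represented by its
  -- coefficient vector c : Fin p → ℤ, meaning Σ_a c(a) ζ_p^a.
  expSumT : (p r k n : ℕ) → Fin p → ℤ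
  expSumT p r k n a =
    ℤ.+ length (filter (λ xs → trace p r (evalT k xs) ≟ natF (toℕ a)) (points n))

-- Equality in ℤ[ζ_p] = ℤ[C_p] / (1 + ζ + ... + ζ^{p-1}) for p prime:
-- Σ c(a) ζ^a = Σ d(a) ζ^a  iff  c - d is a constant vector.
_≈ζ_ : {p : ℕ} → (Fin p → ℤ) → (Fin p → ℤ) → Set
c ≈ζ d = ∀ a b → c a ℤ.- d a ≡ c b ℤ.- d b

-- Coefficients of Q_{T,k,q}(X) = X^k - Σ_{i=1}^k c_i X^{k-i}:
-- c_1 = 0 and c_i = q (q-1)^{i-2} for 2 ≤ i ≤ k (i = l + 2).
recCoeff : (q i : ℕ) → ℤ
recCoeff q zero          = ℤ.+ 0
recCoeff q (suc zero)    = ℤ.+ 0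
recCoeff q (suc (suc l)) = ℤ.+ (q ℕ.* ((q ∸ 1) ℕ.^ l))

recRHS : {p : ℕ} → (q k n : ℕ) → (ℕ → Fin p → ℤ) → Fin p → ℤ
recRHS q k n u a = foldr ℤ._+_ (ℤ.+ 0)
  (map (λ j → recCoeff q (suc j) ℤ.* u (n ∸ suc j) a) (upTo k))

-- Let w be a weight on F_q and N(n) = Σ_{x ∈ F_q^n} w(T(x)); for w the indicator of Tr(c) = a,
-- N(n) is the coefficient of ζ_p^a in S(T(n)).  Since T(x₁, y) = x₁ y₁⋯y_{k−1} + T(y), summing over x₁
-- gives N(m+1) = q Z(m) + W B(m), where W = Σ_c w(c), B(m) counts the y whose product y₁⋯y_{k−1} is
-- nonzero and Z(m) is the weighted count of the y where it vanishes.  Peeling off y₁, y₂, … in the same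
-- way, Z(m) = Σ_{l<k−1} (q−1)^l N(m−1−l), hence N(n) − Σ_i c_i N(n−i) = W B(n−1).  Here B does not
-- depend on a, and neither does W: the trace is additive (Frobenius), F_p-valued (Fermat) and not
-- identically 0 (a polynomial of degree p^{r−1} < q), hence takes the value 1; translating by a
-- preimage of 1 matches the fibres over a and a + 1.  The defect is thus the same integer for every ζ_p^a.

module Submission where

open import Defs
open import Level using (0ℓ)
open import Algebra.Bundles using (CommutativeRing)
open import Algebra.Core using (Op₂)
open import Algebra.Structures using (IsCommutativeMonoid; IsCommutativeRing)
import Algebra.Properties.CommutativeSemiring.Binomial as BinomialProperties
import Algebra.Properties.CommutativeSemiring.Exp as ExpProperties
import Algebra.Properties.Ring as RingProperties
import Algebra.Properties.Semiring.Mult as MultProperties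
import Algebra.Properties.Semiring.Sum as SumProperties
import Algebra.Solver.Ring.NaturalCoefficients.Default as NaturalSolver
open import Data.Nat as ℕ using (ℕ; zero; suc; _+_; _*_; _∸_; _≤_; _<_; z≤n; s≤s)
import Data.Nat.Properties as ℕP
open import Data.Nat.Combinatorics using (_C_; nC1≡n; nCn≡1; nCk+nC[k+1]≡[n+1]C[k+1])
open import Data.Nat.Combinatorics.Specification using (k>n⇒nCk≡0)
open import Data.Nat.Divisibility using (_∣_; divides; ∣⇒≤)
open import Data.Nat.Primality using (Prime; euclidsLemma; prime⇒nonTrivial; prime⇒nonZero)
open import Data.Nat.Tactic.RingSolver using (solve-∀)
open import Data.Integer as ℤ using (ℤ)
import Data.Integer.Properties as ℤP
import Data.Integer.Tactic.RingSolver as ℤSolver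
open import Data.Fin as Fin using (Fin; toℕ; inject₁)
open import Data.Fin.Properties using (toℕ-fromℕ; toℕ-inject₁; toℕ<n)
open import Data.List using (List; []; _∷_; _++_; _∷ʳ_; map; foldr; foldl; filter; length; take; drop; replicate; upTo; concatMap)
import Data.List.Properties as ListP
open import Data.List.Membership.Propositional using (_∈_)
open import Data.List.Membership.Propositional.Properties using (∈-map⁺; ∈-map⁻; ∈-filter⁺; ∈-filter⁻)
open import Data.List.Membership.Propositional.Properties.WithK using (unique∧set⇒bag)
open import Data.List.Relation.Binary.BagAndSetEquality using (∼bag⇒↭)
open import Data.List.Relation.Binary.Permutation.Propositional using (_↭_; ↭⇒↭ₛ)
import Data.List.Relation.Binary.Permutation.Propositional.Properties as ↭P
import Data.List.Relation.Binary.Permutation.Setoid.Properties as ↭ₛP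
open import Data.List.Relation.Unary.All as All using (All; []; _∷_; all?)
import Data.List.Relation.Unary.All.Properties as AllP
open AllP using (all-filter; ¬All⇒Any¬)
open import Data.List.Relation.Unary.AllPairs using (_∷_)
import Data.List.Relation.Unary.Any as Any
open Any using (here; there)
open import Data.List.Relation.Unary.Unique.Propositional using (Unique)
import Data.List.Relation.Unary.Unique.Propositional.Properties as UniqueP
import Data.Vec.Functional as Vector
open import Data.Product using (_,_; proj₁; proj₂; ∃)
open import Data.Sum using (_⊎_; inj₁; inj₂; [_,_]′)
open import Function using (_∘_; mk⇔)
open import Relation.Nullary using (¬_; Dec; yes; no; ¬?; contradiction)
open import Relation.Binary.PropositionalEquality

[1+k]*[1+n]C[1+k]≡[1+n]*nCk : ∀ n k → suc k * (suc n C suc k) ≡ suc n * (n C k)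
[1+k]*[1+n]C[1+k]≡[1+n]*nCk zero    zero    = refl
[1+k]*[1+n]C[1+k]≡[1+n]*nCk zero    (suc k) =
  trans (cong (suc (suc k) *_) (k>n⇒nCk≡0 {1} {suc (suc k)} (s≤s (s≤s z≤n))))
        (trans (ℕP.*-zeroʳ (suc (suc k))) (sym (cong (1 *_) (k>n⇒nCk≡0 {0} {suc k} (s≤s z≤n)))))
[1+k]*[1+n]C[1+k]≡[1+n]*nCk (suc n) zero    =
  trans (ℕP.+-identityʳ _) (trans (nC1≡n (suc (suc n))) (sym (ℕP.*-identityʳ _)))
[1+k]*[1+n]C[1+k]≡[1+n]*nCk (suc n) (suc k) = begin
  suc (suc k) * (suc (suc n) C suc (suc k))
    ≡⟨ cong (suc (suc k) *_) (sym (nCk+nC[k+1]≡[n+1]C[k+1] (suc n) (suc k))) ⟩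
  suc (suc k) * (a + b)
    ≡⟨ regroup k a b ⟩
  suc k * a + a + suc (suc k) * b
    ≡⟨ cong₂ (λ u v → u + a + v) ([1+k]*[1+n]C[1+k]≡[1+n]*nCk n k) ([1+k]*[1+n]C[1+k]≡[1+n]*nCk n (suc k)) ⟩
  suc n * (n C k) + a + suc n * (n C suc k)
    ≡⟨ regroup′ n (n C k) a (n C suc k) ⟩
  suc n * (n C k + n C suc k) + a
    ≡⟨ cong (λ c → suc n * c + a) (nCk+nC[k+1]≡[n+1]C[k+1] n k) ⟩
  suc n * a + a
    ≡⟨ ℕP.+-comm (suc n * a) a ⟩
  suc (suc n) * a ∎
  where
    open ≡-Reasoning
    a = suc n C suc k
    b = suc n C suc (suc k)
    regroup : ∀ k a b → suc (suc k) * (a + b) ≡ suc k * a + a + suc (suc k) * b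
    regroup = solve-∀
    regroup′ : ∀ n c a d → suc n * c + a + suc n * d ≡ suc n * (c + d) + a
    regroup′ = solve-∀

prime∣pCk : ∀ {p k} → Prime p → 0 < k → k < p → p ∣ p C k
prime∣pCk {suc n} {suc k} pp _ k<p
  with euclidsLemma (suc k) (suc n C suc k) pp
         (divides (n C k) (trans ([1+k]*[1+n]C[1+k]≡[1+n]*nCk n k) (ℕP.*-comm (suc n) _)))
... | inj₂ p∣pCk = p∣pCk
... | inj₁ p∣k   = contradiction (∣⇒≤ p∣k) (ℕP.<⇒≱ k<p)

module Sum {A : Set} {_∙_ : Op₂ A} {ε : A} (isCM : IsCommutativeMonoid _≡_ _∙_ ε) where
  open IsCommutativeMonoid isCM using (assoc; comm; identityˡ; identityʳ)
  open ≡-Reasoning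

  private variable X Y : Set

  ∑ : List X → (X → A) → A
  ∑ xs f = foldr _∙_ ε (map f xs)

  ∑-cong : ∀ xs {f g : X → A} → (∀ x → f x ≡ g x) → ∑ xs f ≡ ∑ xs g
  ∑-cong []       f≗g = refl
  ∑-cong (x ∷ xs) f≗g = cong₂ _∙_ (f≗g x) (∑-cong xs f≗g)

  ∑-congᴬ : ∀ {xs} {f g : X → A} → All (λ x → f x ≡ g x) xs → ∑ xs f ≡ ∑ xs g
  ∑-congᴬ []           = refl
  ∑-congᴬ (fx≡gx ∷ eqs) = cong₂ _∙_ fx≡gx (∑-congᴬ eqs)

  ∑-ε : ∀ (xs : List X) → ∑ xs (λ _ → ε) ≡ ε
  ∑-ε []       = refl
  ∑-ε (x ∷ xs) = trans (identityˡ _) (∑-ε xs)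

  ∑-∙ : ∀ xs (f g : X → A) → ∑ xs (λ x → f x ∙ g x) ≡ ∑ xs f ∙ ∑ xs g
  ∑-∙ []       f g = sym (identityˡ ε)
  ∑-∙ (x ∷ xs) f g = begin
    (f x ∙ g x) ∙ ∑ xs (λ x → f x ∙ g x) ≡⟨ cong ((f x ∙ g x) ∙_) (∑-∙ xs f g) ⟩
    (f x ∙ g x) ∙ (∑ xs f ∙ ∑ xs g)      ≡⟨ interchange (f x) (g x) (∑ xs f) (∑ xs g) ⟩
    (f x ∙ ∑ xs f) ∙ (g x ∙ ∑ xs g)      ∎
    where
      interchange : ∀ a b c d → (a ∙ b) ∙ (c ∙ d) ≡ (a ∙ c) ∙ (b ∙ d)
      interchange a b c d = begin
        (a ∙ b) ∙ (c ∙ d) ≡⟨ assoc a b (c ∙ d) ⟩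
        a ∙ (b ∙ (c ∙ d)) ≡⟨ cong (a ∙_) (sym (assoc b c d)) ⟩
        a ∙ ((b ∙ c) ∙ d) ≡⟨ cong (λ t → a ∙ (t ∙ d)) (comm b c) ⟩
        a ∙ ((c ∙ b) ∙ d) ≡⟨ cong (a ∙_) (assoc c b d) ⟩
        a ∙ (c ∙ (b ∙ d)) ≡⟨ sym (assoc a c (b ∙ d)) ⟩
        (a ∙ c) ∙ (b ∙ d) ∎

  ∑-++ : ∀ xs ys (f : X → A) → ∑ (xs ++ ys) f ≡ ∑ xs f ∙ ∑ ys f
  ∑-++ []       ys f = sym (identityˡ _)
  ∑-++ (x ∷ xs) ys f = trans (cong (f x ∙_) (∑-++ xs ys f)) (sym (assoc _ _ _))

  ∑-↭ : ∀ {xs ys} (f : X → A) → xs ↭ ys → ∑ xs f ≡ ∑ ys f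
  ∑-↭ f xs↭ys = ↭ₛP.foldr-commMonoid (setoid A) isCM (↭⇒↭ₛ (↭P.map⁺ f xs↭ys))

  ∑-swap : ∀ xs (ys : List Y) (g : X → Y → A) →
           ∑ xs (λ x → ∑ ys (g x)) ≡ ∑ ys (λ y → ∑ xs (λ x → g x y))
  ∑-swap []       ys g = sym (∑-ε ys)
  ∑-swap (x ∷ xs) ys g = trans (cong (∑ ys (g x) ∙_) (∑-swap xs ys g))
                               (sym (∑-∙ ys (g x) (λ y → ∑ xs (λ x′ → g x′ y))))

  ∑-hom : ∀ {B : Set} {_◦_ : Op₂ B} {e : B} (h : B → A) → h e ≡ ε →
          (∀ a b → h (a ◦ b) ≡ h a ∙ h b) →
          ∀ xs (f : X → B) → h (foldr _◦_ e (map f xs)) ≡ ∑ xs (h ∘ f)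
  ∑-hom h h-e h-∘ []       f = h-e
  ∑-hom h h-e h-∘ (x ∷ xs) f = trans (h-∘ _ _) (cong (h (f x) ∙_) (∑-hom h h-e h-∘ xs f))

  ∑-map : ∀ xs (g : X → Y) (f : Y → A) → ∑ (map g xs) f ≡ ∑ xs (f ∘ g)
  ∑-map xs g f = cong (foldr _∙_ ε) (sym (ListP.map-∘ xs))

  ∑-concatMap : ∀ xs (g : X → List Y) (f : Y → A) →
                ∑ (concatMap g xs) f ≡ ∑ xs (λ x → ∑ (g x) f)
  ∑-concatMap []       g f = refl
  ∑-concatMap (x ∷ xs) g f = trans (∑-++ (g x) (concatMap g xs) f) (cong (∑ (g x) f ∙_) (∑-concatMap xs g f))

  ∑-upTo-suc : ∀ n (f : ℕ → A) → ∑ (upTo (suc n)) f ≡ f 0 ∙ ∑ (upTo n) (f ∘ suc)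
  ∑-upTo-suc n f = cong (λ l → f 0 ∙ foldr _∙_ ε l)
    (trans (ListP.map-applyUpTo suc f n) (sym (ListP.map-applyUpTo (λ i → i) (f ∘ suc) n)))

  ∑-upTo-last : ∀ n (f : ℕ → A) → ∑ (upTo (suc n)) f ≡ ∑ (upTo n) f ∙ f n
  ∑-upTo-last n f = begin
    ∑ (upTo (suc n)) f      ≡⟨ cong (λ l → ∑ l f) (sym (ListP.upTo-∷ʳ n)) ⟩
    ∑ (upTo n ∷ʳ n) f       ≡⟨ ∑-++ (upTo n) (n ∷ []) f ⟩
    ∑ (upTo n) f ∙ (f n ∙ ε) ≡⟨ cong (∑ (upTo n) f ∙_) (identityʳ (f n)) ⟩
    ∑ (upTo n) f ∙ f n      ∎

𝟙 : {P : Set} → Dec P → ℕ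
𝟙 (yes _) = 1
𝟙 (no _)  = 0

𝟙-yes : {P : Set} (P? : Dec P) → P → 𝟙 P? ≡ 1
𝟙-yes (yes _) _ = refl
𝟙-yes (no ¬p) p = contradiction p ¬p

𝟙-no : {P : Set} (P? : Dec P) → ¬ P → 𝟙 P? ≡ 0
𝟙-no (yes p) ¬p = contradiction p ¬p
𝟙-no (no _)  _  = refl

𝟙-cong : {P Q : Set} (P? : Dec P) (Q? : Dec Q) → (P → Q) → (Q → P) → 𝟙 P? ≡ 𝟙 Q?
𝟙-cong (yes _) (yes _) _   _   = refl
𝟙-cong (yes p) (no ¬q) P→Q _   = contradiction (P→Q p) ¬q
𝟙-cong (no ¬p) (yes q) _   Q→P = contradiction (Q→P q) ¬p
𝟙-cong (no _)  (no _)  _   _   = refl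

module ℕΣ = Sum ℕP.+-0-isCommutativeMonoid

∑-*ˡ : {A : Set} (c : ℕ) (xs : List A) (f : A → ℕ) → ℕΣ.∑ xs (λ x → c * f x) ≡ c * ℕΣ.∑ xs f
∑-*ˡ c xs f = sym (ℕΣ.∑-hom (c *_) (ℕP.*-zeroʳ c) (ℕP.*-distribˡ-+ c) xs f)

length-filter≡∑𝟙 : {A : Set} {P : A → Set} (P? : ∀ x → Dec (P x)) (xs : List A) →
                   length (filter P? xs) ≡ ℕΣ.∑ xs (𝟙 ∘ P?)
length-filter≡∑𝟙 P? []       = refl
length-filter≡∑𝟙 P? (x ∷ xs) with P? x
... | yes _ = cong suc (length-filter≡∑𝟙 P? xs)
... | no  _ = length-filter≡∑𝟙 P? xs

∑-const : {A : Set} (xs : List A) (f : A → ℕ) (c : ℕ) → All (λ x → f x ≡ c) xs → ℕΣ.∑ xs f ≡ length xs * c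
∑-const []       f c []           = refl
∑-const (x ∷ xs) f c (fx≡c ∷ all) = cong₂ _+_ fx≡c (∑-const xs f c all)

unique-↭ : {A : Set} {xs ys : List A} → Unique xs → Unique ys →
           (∀ {z} → z ∈ xs → z ∈ ys) → (∀ {z} → z ∈ ys → z ∈ xs) → xs ↭ ys
unique-↭ xs! ys! xs⊆ys ys⊆xs = ∼bag⇒↭ (unique∧set⇒bag xs! ys! (mk⇔ xs⊆ys ys⊆xs))

map-↭ : {A : Set} {xs : List A} (σ τ : A → A) → Unique xs →
        (∀ x → τ (σ x) ≡ x) → (∀ y → σ (τ y) ≡ y) →
        (∀ {x} → x ∈ xs → σ x ∈ xs) → (∀ {y} → y ∈ xs → τ y ∈ xs) → map σ xs ↭ xs
map-↭ {xs = xs} σ τ xs! τσ στ σ-closed τ-closed =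
  unique-↭ (UniqueP.map⁺ σ-injective xs!) xs! image⊆ ⊆image
  where
    σ-injective : ∀ {x y} → σ x ≡ σ y → x ≡ y
    σ-injective {x} {y} eq = trans (sym (τσ x)) (trans (cong τ eq) (τσ y))
    image⊆ : ∀ {z} → z ∈ map σ xs → z ∈ xs
    image⊆ z∈ with ∈-map⁻ σ z∈
    ... | x , x∈ , refl = σ-closed x∈
    ⊆image : ∀ {z} → z ∈ xs → z ∈ map σ xs
    ⊆image {z} z∈ = subst (_∈ map σ xs) (στ z) (∈-map⁺ σ (τ-closed z∈))

module FiniteFieldProperties (F : FiniteField) where
  open FiniteField F renaming (_+_ to _⊕_; _*_ to _⊗_; -_ to ⊖_)
  open IsCommutativeRing isCommutativeRing hiding (refl; sym; trans; reflexive; zero)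
  open ≡-Reasoning

  commutativeRing : CommutativeRing 0ℓ 0ℓ
  commutativeRing = record { isCommutativeRing = isCommutativeRing }

  module RP = RingProperties (CommutativeRing.ring commutativeRing)

  module +Σ = Sum +-isCommutativeMonoid
  module *Π = Sum *-isCommutativeMonoid

  q : ℕ
  q = length elements

  1≢0 : 1# ≢ 0#
  1≢0 = 0≢1 ∘ sym

  ⊗≡0⇒ : ∀ x y → x ⊗ y ≡ 0# → x ≡ 0# ⊎ y ≡ 0#
  ⊗≡0⇒ x y xy≡0 with x ≟ 0#
  ... | yes x≡0 = inj₁ x≡0
  ... | no  x≢0 with inverse x x≢0
  ...   | x⁻¹ , xx⁻¹≡1 = inj₂ (begin
    y               ≡⟨ sym (*-identityˡ y) ⟩
    1# ⊗ y          ≡⟨ cong (_⊗ y) (trans (sym xx⁻¹≡1) (*-comm x x⁻¹)) ⟩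
    (x⁻¹ ⊗ x) ⊗ y   ≡⟨ *-assoc x⁻¹ x y ⟩
    x⁻¹ ⊗ (x ⊗ y)   ≡⟨ cong (x⁻¹ ⊗_) xy≡0 ⟩
    x⁻¹ ⊗ 0#        ≡⟨ zeroʳ x⁻¹ ⟩
    0#              ∎)

  ⊗-≢0 : ∀ {x y} → x ≢ 0# → y ≢ 0# → x ⊗ y ≢ 0#
  ⊗-≢0 {x} {y} x≢0 y≢0 xy≡0 with ⊗≡0⇒ x y xy≡0
  ... | inj₁ x≡0 = x≢0 x≡0
  ... | inj₂ y≡0 = y≢0 y≡0

  ⊗-cancelʳ : ∀ {a b c} → c ≢ 0# → a ⊗ c ≡ b ⊗ c → a ≡ b
  ⊗-cancelʳ {a} {b} {c} c≢0 ac≡bc =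
    [ RP.x∙y⁻¹≈ε⇒x≈y a b , (λ c≡0 → contradiction c≡0 c≢0) ]′ (⊗≡0⇒ (a ⊕ ⊖ b) c [a-b]c≡0)
    where
      [a-b]c≡0 : (a ⊕ ⊖ b) ⊗ c ≡ 0#
      [a-b]c≡0 = begin
        (a ⊕ ⊖ b) ⊗ c        ≡⟨ distribʳ c a (⊖ b) ⟩
        a ⊗ c ⊕ ⊖ b ⊗ c      ≡⟨ cong (a ⊗ c ⊕_) (RP.-‿distribˡ-* b c) ⟨
        a ⊗ c ⊕ ⊖ (b ⊗ c)    ≡⟨ cong (λ t → t ⊕ ⊖ (b ⊗ c)) ac≡bc ⟩
        b ⊗ c ⊕ ⊖ (b ⊗ c)    ≡⟨ -‿inverseʳ (b ⊗ c) ⟩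
        0#                   ∎

  nonzeros : List Carrier
  nonzeros = filter (λ x → ¬? (x ≟ 0#)) elements

  elements↭0∷nonzeros : elements ↭ 0# ∷ nonzeros
  elements↭0∷nonzeros = unique-↭ unique (0∉nonzeros ∷ UniqueP.filter⁺ _ unique) to (λ {z} _ → complete z)
    where
      0∉nonzeros : All (0# ≢_) nonzeros
      0∉nonzeros = All.map (_∘ sym) (all-filter _ elements)
      to : ∀ {z} → z ∈ elements → z ∈ 0# ∷ nonzeros
      to {z} z∈ with z ≟ 0#
      ... | yes refl = here refl
      ... | no  z≢0  = there (∈-filter⁺ _ z∈ z≢0)

  q≡1+∣nonzeros∣ : q ≡ suc (length nonzeros)
  q≡1+∣nonzeros∣ = ↭P.↭-length elements↭0∷nonzeros

  ∑-split0 : (h : Carrier → ℕ) (B : ℕ) → (∀ y → y ≢ 0# → h y ≡ B) → ℕΣ.∑ elements h ≡ h 0# + (q ∸ 1) * B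
  ∑-split0 h B h≡B = begin
    ℕΣ.∑ elements h              ≡⟨ ℕΣ.∑-↭ h elements↭0∷nonzeros ⟩
    h 0# + ℕΣ.∑ nonzeros h       ≡⟨ cong (h 0# +_) (∑-const nonzeros h B (All.map (h≡B _) (all-filter _ elements))) ⟩
    h 0# + length nonzeros * B   ≡⟨ cong (λ n → h 0# + ℕ.pred n * B) q≡1+∣nonzeros∣ ⟨
    h 0# + (q ∸ 1) * B           ∎

  permutation-↭ : (σ τ : Carrier → Carrier) → (∀ x → τ (σ x) ≡ x) → (∀ y → σ (τ y) ≡ y) →
                  map σ elements ↭ elements
  permutation-↭ σ τ τσ στ = map-↭ σ τ unique τσ στ (λ {x} _ → complete (σ x)) (λ {y} _ → complete (τ y))

  translate-↭ : ∀ c → map (_⊕ c) elements ↭ elements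
  translate-↭ c = permutation-↭ (_⊕ c) (_⊕ ⊖ c) (RP.//-rightDividesʳ c) (RP.//-rightDividesˡ c)

  ⊗-inverse-cancel : ∀ {u v} → u ⊗ v ≡ 1# → ∀ x → (x ⊗ u) ⊗ v ≡ x
  ⊗-inverse-cancel {u} {v} uv≡1 x = trans (*-assoc x u v) (trans (cong (x ⊗_) uv≡1) (*-identityʳ x))

  scale-↭ : ∀ {u} → u ≢ 0# → map (_⊗ u) elements ↭ elements
  scale-↭ {u} u≢0 with inverse u u≢0
  ... | u⁻¹ , uu⁻¹≡1 =
    permutation-↭ (_⊗ u) (_⊗ u⁻¹) (⊗-inverse-cancel uu⁻¹≡1) (⊗-inverse-cancel (trans (*-comm u⁻¹ u) uu⁻¹≡1))

  scale-nonzeros-↭ : ∀ {u} → u ≢ 0# → map (_⊗ u) nonzeros ↭ nonzeros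
  scale-nonzeros-↭ {u} u≢0 with inverse u u≢0
  ... | u⁻¹ , uu⁻¹≡1 =
    map-↭ (_⊗ u) (_⊗ u⁻¹) (UniqueP.filter⁺ _ unique)
      (⊗-inverse-cancel uu⁻¹≡1) (⊗-inverse-cancel (trans (*-comm u⁻¹ u) uu⁻¹≡1))
      (scale-closed u≢0) (scale-closed (λ u⁻¹≡0 → 1≢0 (trans (sym uu⁻¹≡1) (trans (cong (u ⊗_) u⁻¹≡0) (zeroʳ u)))))
    where
      scale-closed : ∀ {c} → c ≢ 0# → ∀ {x} → x ∈ nonzeros → x ⊗ c ∈ nonzeros
      scale-closed c≢0 {x} x∈ = ∈-filter⁺ _ (complete (x ⊗ _)) (⊗-≢0 (proj₂ (∈-filter⁻ _ {xs = elements} x∈)) c≢0)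

module Polynomial (F : FiniteField) where
  open FiniteField F renaming (_+_ to _⊕_; _*_ to _⊗_; -_ to ⊖_)
  open FiniteFieldProperties F
  open CommutativeRing commutativeRing
    using (+-identityˡ; +-identityʳ; *-identityʳ; zeroˡ; commutativeSemiring)
  open ExpProperties commutativeSemiring using (_^_)
  open NaturalSolver commutativeSemiring using (solve; _:+_; _:*_; _:=_; con)
  open ≡-Reasoning

  -- horner c cs x evaluates at x the polynomial with coefficients c ∷ cs, highest degree first
  horner : Carrier → List Carrier → Carrier → Carrier
  horner c cs x = foldl (λ acc d → acc ⊗ x ⊕ d) c cs

  horner-0∷ : ∀ c cs x → horner 0# (c ∷ cs) x ≡ horner c cs x
  horner-0∷ c cs x = cong (λ a → horner a cs x) (trans (cong (_⊕ c) (zeroˡ x)) (+-identityˡ c))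

  horner-leading : ∀ c cs x → horner c cs x ≡ c ⊗ x ^ length cs ⊕ horner 0# cs x
  horner-leading c []       x = sym (trans (+-identityʳ _) (*-identityʳ c))
  horner-leading c (d ∷ ds) x = begin
    horner (c ⊗ x ⊕ d) ds x                 ≡⟨ horner-leading (c ⊗ x ⊕ d) ds x ⟩
    (c ⊗ x ⊕ d) ⊗ X ⊕ H                     ≡⟨ solve 5 (λ c x d X H → (c :* x :+ d) :* X :+ H := c :* (x :* X) :+ (d :* X :+ H)) refl c x d X H ⟩
    c ⊗ (x ⊗ X) ⊕ (d ⊗ X ⊕ H)               ≡⟨ cong (c ⊗ (x ⊗ X) ⊕_) (trans (horner-0∷ d ds x) (horner-leading d ds x)) ⟨
    c ⊗ (x ⊗ X) ⊕ horner 0# (d ∷ ds) x      ∎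
    where
      X = x ^ length ds
      H = horner 0# ds x

  -- coefficients of the quotient by X − a, leading coefficient first
  synthDiv : Carrier → Carrier → List Carrier → List Carrier
  synthDiv a c []       = []
  synthDiv a c (d ∷ ds) = c ∷ synthDiv a (c ⊗ a ⊕ d) ds

  length-synthDiv : ∀ a c cs → length (synthDiv a c cs) ≡ length cs
  length-synthDiv a c []       = refl
  length-synthDiv a c (d ∷ ds) = cong suc (length-synthDiv a _ ds)

  -- P(x) = (x − a) Q(x) + P(a), with the subtraction moved across
  horner-factor : ∀ a c cs x → let Q = horner 0# (synthDiv a c cs) x in
                  horner c cs x ⊕ a ⊗ Q ≡ x ⊗ Q ⊕ horner c cs a
  horner-factor a c []       x = solve 3 (λ c a x → c :+ a :* con 0 := x :* con 0 :+ c) refl c a x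
  horner-factor a c (d ∷ ds) x = begin
    horner (c ⊗ x ⊕ d) ds x ⊕ a ⊗ horner 0# (c ∷ Q′) x
      ≡⟨ cong₂ (λ u v → u ⊕ a ⊗ v) (horner-leading _ ds x) (trans (horner-0∷ c Q′ x) (horner-leading c Q′ x)) ⟩
    (c ⊗ x ⊕ d) ⊗ x ^ length ds ⊕ Hd ⊕ a ⊗ (c ⊗ x ^ length Q′ ⊕ H′)
      ≡⟨ cong (λ n → (c ⊗ x ⊕ d) ⊗ x ^ length ds ⊕ Hd ⊕ a ⊗ (c ⊗ x ^ n ⊕ H′)) (length-synthDiv a _ ds) ⟩
    (c ⊗ x ⊕ d) ⊗ X ⊕ Hd ⊕ a ⊗ (c ⊗ X ⊕ H′)
      ≡⟨ solve 7 (λ c x d X Hd a H′ → (c :* x :+ d) :* X :+ Hd :+ a :* (c :* X :+ H′)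
                   := c :* x :* X :+ ((c :* a :+ d) :* X :+ Hd :+ a :* H′)) refl c x d X Hd a H′ ⟩
    c ⊗ x ⊗ X ⊕ ((c ⊗ a ⊕ d) ⊗ X ⊕ Hd ⊕ a ⊗ H′)
      ≡⟨ cong (λ z → c ⊗ x ⊗ X ⊕ (z ⊕ a ⊗ H′)) (horner-leading _ ds x) ⟨
    c ⊗ x ⊗ X ⊕ (horner (c ⊗ a ⊕ d) ds x ⊕ a ⊗ H′)
      ≡⟨ cong (c ⊗ x ⊗ X ⊕_) (horner-factor a (c ⊗ a ⊕ d) ds x) ⟩
    c ⊗ x ⊗ X ⊕ (x ⊗ H′ ⊕ R)
      ≡⟨ solve 5 (λ c x X H′ R → c :* x :* X :+ (x :* H′ :+ R) := x :* (c :* X :+ H′) :+ R) refl c x X H′ R ⟩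
    x ⊗ (c ⊗ X ⊕ H′) ⊕ R
      ≡⟨ cong (λ z → x ⊗ z ⊕ R) (trans (horner-0∷ c Q′ x) (trans (horner-leading c Q′ x)
            (cong (λ n → c ⊗ x ^ n ⊕ H′) (length-synthDiv a _ ds)))) ⟨
    x ⊗ horner 0# (c ∷ Q′) x ⊕ R ∎
    where
      Q′ = synthDiv a (c ⊗ a ⊕ d) ds
      X  = x ^ length ds
      Hd = horner 0# ds x
      H′ = horner 0# Q′ x
      R  = horner (c ⊗ a ⊕ d) ds a

  roots≤degree : ∀ {c} cs → c ≢ 0# → ∀ {rs} → Unique rs → All (λ a → horner c cs a ≡ 0#) rs →
                 length rs ≤ length cs
  roots≤degree cs       c≢0 {[]}     _          _               = z≤n
  roots≤degree []       c≢0 {a ∷ rs} _          (c≡0 ∷ _)       = contradiction c≡0 c≢0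
  roots≤degree {c} (d ∷ ds) c≢0 {a ∷ rs} (a∉rs ∷ rs!) (Pa≡0 ∷ Prs≡0) =
    s≤s (subst (length rs ≤_) (length-synthDiv a _ ds)
          (roots≤degree Q′ c≢0 rs! (All.zipWith (λ (a≢b , Pb≡0) → quotient-root a≢b Pb≡0) (a∉rs , Prs≡0))))
    where
      Q′ = synthDiv a (c ⊗ a ⊕ d) ds
      quotient-root : ∀ {b} → a ≢ b → horner c (d ∷ ds) b ≡ 0# → horner c Q′ b ≡ 0#
      quotient-root {b} a≢b Pb≡0 with horner c Q′ b ≟ 0#
      ... | yes Qb≡0 = Qb≡0
      ... | no  Qb≢0 = contradiction (⊗-cancelʳ Qb≢0 aQ≡bQ) a≢b
        where
          aQ≡bQ : a ⊗ horner c Q′ b ≡ b ⊗ horner c Q′ b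
          aQ≡bQ = begin
            a ⊗ horner c Q′ b                         ≡⟨ cong (a ⊗_) (horner-0∷ c Q′ b) ⟨
            a ⊗ horner 0# (c ∷ Q′) b                  ≡⟨ +-identityˡ _ ⟨
            0# ⊕ a ⊗ horner 0# (c ∷ Q′) b             ≡⟨ cong (_⊕ a ⊗ horner 0# (c ∷ Q′) b) Pb≡0 ⟨
            horner c (d ∷ ds) b ⊕ a ⊗ horner 0# (c ∷ Q′) b ≡⟨ horner-factor a c (d ∷ ds) b ⟩
            b ⊗ horner 0# (c ∷ Q′) b ⊕ horner c (d ∷ ds) a ≡⟨ cong (b ⊗ horner 0# (c ∷ Q′) b ⊕_) Pa≡0 ⟩
            b ⊗ horner 0# (c ∷ Q′) b ⊕ 0#             ≡⟨ +-identityʳ _ ⟩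
            b ⊗ horner 0# (c ∷ Q′) b                  ≡⟨ cong (b ⊗_) (horner-0∷ c Q′ b) ⟩
            b ⊗ horner c Q′ b                         ∎

module FrobeniusAndTrace (F : FiniteField) where
  open FiniteField F renaming (_+_ to _⊕_; _*_ to _⊗_; -_ to ⊖_)
  open FiniteFieldProperties F
  open CommutativeRing commutativeRing
    using (+-identityʳ; +-comm; *-identityˡ; *-identityʳ; *-comm; *-assoc; zeroˡ; zeroʳ; distribʳ;
           commutativeSemiring; semiring)
  open ExpProperties commutativeSemiring using (_^_; ^-homo-*; ^-assocʳ; ^-distrib-*)
  open MultProperties semiring using (_×_; ×-assoc-*; ×1-homo-*)
  open Polynomial F
  open ≡-Reasoning

  fpow≡^ : ∀ x n → fpow F x n ≡ x ^ n
  fpow≡^ x zero    = refl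
  fpow≡^ x (suc n) = cong (x ⊗_) (fpow≡^ x n)

  ^≡0⇒≡0 : ∀ {x} n → x ^ n ≡ 0# → x ≡ 0#
  ^≡0⇒≡0         zero    1≡0   = contradiction 1≡0 1≢0
  ^≡0⇒≡0 {x} (suc n) xxⁿ≡0 with ⊗≡0⇒ x (x ^ n) xxⁿ≡0
  ... | inj₁ x≡0  = x≡0
  ... | inj₂ xⁿ≡0 = ^≡0⇒≡0 n xⁿ≡0

  ×≡×1⊗ : ∀ n x → n × x ≡ (n × 1#) ⊗ x
  ×≡×1⊗ n x = trans (cong (n ×_) (sym (*-identityˡ x))) (sym (×-assoc-* n 1# x))

  q×1≡0 : q × 1# ≡ 0#
  q×1≡0 = RP.+-identityˡ-unique (q × 1#) Σx (begin
    q × 1# ⊕ Σx                           ≡⟨ cong (_⊕ Σx) (∑1 elements) ⟨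
    +Σ.∑ elements (λ _ → 1#) ⊕ Σx         ≡⟨ +-comm _ Σx ⟩
    Σx ⊕ +Σ.∑ elements (λ _ → 1#)         ≡⟨ +Σ.∑-∙ elements (λ x → x) (λ _ → 1#) ⟨
    +Σ.∑ elements (_⊕ 1#)                 ≡⟨ +Σ.∑-map elements (_⊕ 1#) (λ x → x) ⟨
    +Σ.∑ (map (_⊕ 1#) elements) (λ x → x) ≡⟨ +Σ.∑-↭ (λ x → x) (translate-↭ 1#) ⟩
    Σx                                    ∎)
    where
      Σx : Carrier
      Σx = +Σ.∑ elements (λ x → x)
      ∑1 : ∀ (xs : List Carrier) → +Σ.∑ xs (λ _ → 1#) ≡ length xs × 1#
      ∑1 []       = refl
      ∑1 (x ∷ xs) = cong (1# ⊕_) (∑1 xs)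

  q≡pʳ⇒p×1≡0 : ∀ p r → q ≡ p ℕ.^ r → p × 1# ≡ 0#
  q≡pʳ⇒p×1≡0 p r q≡pʳ = ^≡0⇒≡0 r (trans (sym (pʳ×1 r)) (trans (cong (_× 1#) (sym q≡pʳ)) q×1≡0))
    where
      pʳ×1 : ∀ r → (p ℕ.^ r) × 1# ≡ (p × 1#) ^ r
      pʳ×1 zero    = +-identityʳ 1#
      pʳ×1 (suc r) = trans (×1-homo-* p (p ℕ.^ r)) (cong ((p × 1#) ⊗_) (pʳ×1 r))

  module Frobenius {p : ℕ} (p-prime : Prime p) (p×1≡0 : p × 1# ≡ 0#) where
    private
      module Binomial = BinomialProperties commutativeSemiring
      module VSum = SumProperties semiring

    p∣n⇒n×x≡0 : ∀ {n} x → p ∣ n → n × x ≡ 0#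
    p∣n⇒n×x≡0 {n} x (divides d n≡dp) = begin
      n × x                           ≡⟨ ×≡×1⊗ n x ⟩
      (n × 1#) ⊗ x                    ≡⟨ cong (λ m → (m × 1#) ⊗ x) n≡dp ⟩
      ((d ℕ.* p) × 1#) ⊗ x            ≡⟨ cong (_⊗ x) (×1-homo-* d p) ⟩
      ((d × 1#) ⊗ (p × 1#)) ⊗ x       ≡⟨ cong (λ t → ((d × 1#) ⊗ t) ⊗ x) p×1≡0 ⟩
      ((d × 1#) ⊗ 0#) ⊗ x             ≡⟨ cong (_⊗ x) (zeroʳ _) ⟩
      0# ⊗ x                          ≡⟨ zeroˡ x ⟩
      0#                              ∎

    frobenius : ∀ x y → (x ⊕ y) ^ p ≡ x ^ p ⊕ y ^ p
    frobenius x y = expand p p-prime refl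
      where
        -- matching on a copy of p exposes p = 2 + n
        expand : ∀ n → Prime n → n ≡ p → (x ⊕ y) ^ n ≡ x ^ n ⊕ y ^ n
        expand (suc (suc n)) n-prime refl = begin
          (x ⊕ y) ^ P                               ≡⟨ Binomial.theorem P x y ⟩
          VSum.sum t                                ≡⟨ VSum.sum-init-last t ⟩
          (t Fin.zero ⊕ VSum.sum (t ∘ Fin.suc ∘ inject₁)) ⊕ Vector.last t
            ≡⟨ cong₂ (λ a b → (t Fin.zero ⊕ a) ⊕ b) (trans (VSum.sum-cong-≗ middle≡0) (VSum.sum-replicate-zero (suc n))) last≡xᴾ ⟩
          (t Fin.zero ⊕ 0#) ⊕ x ^ P                 ≡⟨ cong (_⊕ x ^ P) (trans (+-identityʳ _) first≡yᴾ) ⟩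
          y ^ P ⊕ x ^ P                             ≡⟨ +-comm _ _ ⟩
          x ^ P ⊕ y ^ P                             ∎
          where
            P : ℕ
            P = suc (suc n)
            t : Fin (suc P) → Carrier
            t i = (P C toℕ i) × ((x ^ toℕ i) ⊗ (y ^ (P ∸ toℕ i)))
            first≡yᴾ : t Fin.zero ≡ y ^ P
            first≡yᴾ = trans (+-identityʳ _) (*-identityˡ _)
            last≡xᴾ : Vector.last t ≡ x ^ P
            last≡xᴾ = begin
              Vector.last t                                ≡⟨ cong (λ j → (P C j) × ((x ^ j) ⊗ (y ^ (P ∸ j)))) (toℕ-fromℕ P) ⟩
              (P C P) × ((x ^ P) ⊗ (y ^ (P ∸ P)))          ≡⟨ cong₂ (λ a b → a × ((x ^ P) ⊗ (y ^ b))) (nCn≡1 P) (ℕP.n∸n≡0 P) ⟩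
              (x ^ P) ⊗ 1# ⊕ 0#                            ≡⟨ trans (+-identityʳ _) (*-identityʳ _) ⟩
              x ^ P                                        ∎
            middle≡0 : ∀ i → t (Fin.suc (inject₁ i)) ≡ 0#
            middle≡0 i = p∣n⇒n×x≡0 _ (prime∣pCk n-prime (s≤s z≤n)
                           (s≤s (subst (_< suc n) (sym (toℕ-inject₁ i)) (toℕ<n i))))

    frobenius-^ : ∀ j x y → (x ⊕ y) ^ (p ℕ.^ j) ≡ x ^ (p ℕ.^ j) ⊕ y ^ (p ℕ.^ j)
    frobenius-^ zero    x y = trans (*-identityʳ _) (cong₂ _⊕_ (sym (*-identityʳ x)) (sym (*-identityʳ y)))
    frobenius-^ (suc j) x y = begin
      (x ⊕ y) ^ (p ℕ.* p ℕ.^ j)                   ≡⟨ ^-pⁿ⁺¹ (x ⊕ y) ⟩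
      ((x ⊕ y) ^ (p ℕ.^ j)) ^ p                   ≡⟨ cong (_^ p) (frobenius-^ j x y) ⟩
      (x ^ (p ℕ.^ j) ⊕ y ^ (p ℕ.^ j)) ^ p         ≡⟨ frobenius _ _ ⟩
      (x ^ (p ℕ.^ j)) ^ p ⊕ (y ^ (p ℕ.^ j)) ^ p   ≡⟨ cong₂ _⊕_ (^-pⁿ⁺¹ x) (^-pⁿ⁺¹ y) ⟨
      x ^ (p ℕ.* p ℕ.^ j) ⊕ y ^ (p ℕ.* p ℕ.^ j)   ∎
      where
        ^-pⁿ⁺¹ : ∀ z → z ^ (p ℕ.* p ℕ.^ j) ≡ (z ^ (p ℕ.^ j)) ^ p
        ^-pⁿ⁺¹ z = trans (cong (z ^_) (ℕP.*-comm p (p ℕ.^ j))) (sym (^-assocʳ z (p ℕ.^ j) p))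

  fermat : ∀ x → x ^ q ≡ x
  fermat x with x ≟ 0#
  ... | yes refl = subst (λ n → 0# ^ n ≡ 0#) (sym q≡1+∣nonzeros∣) (zeroˡ _)
  ... | no  x≢0  = subst (λ n → x ^ n ≡ x) (sym q≡1+∣nonzeros∣)
                         (trans (cong (x ⊗_) (xⁿ≡1 x≢0)) (*-identityʳ x))
    where
      ∏ : Carrier
      ∏ = *Π.∑ nonzeros (λ y → y)
      ∏≢0 : ∏ ≢ 0#
      ∏≢0 = nonzero-product (all-filter _ elements)
        where
          nonzero-product : ∀ {ys} → All (_≢ 0#) ys → *Π.∑ ys (λ y → y) ≢ 0#
          nonzero-product []             = 1≢0
          nonzero-product (y≢0 ∷ ys≢0) = ⊗-≢0 y≢0 (nonzero-product ys≢0)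
      ∏const : ∀ a (ys : List Carrier) → *Π.∑ ys (λ _ → a) ≡ a ^ length ys
      ∏const a []       = refl
      ∏const a (y ∷ ys) = cong (a ⊗_) (∏const a ys)
      xⁿ≡1 : ∀ {x} → x ≢ 0# → x ^ length nonzeros ≡ 1#
      xⁿ≡1 {x} x≢0 = ⊗-cancelʳ ∏≢0 (begin
        x ^ length nonzeros ⊗ ∏                     ≡⟨ cong (_⊗ ∏) (∏const x nonzeros) ⟨
        *Π.∑ nonzeros (λ _ → x) ⊗ ∏                 ≡⟨ *Π.∑-∙ nonzeros (λ _ → x) (λ y → y) ⟨
        *Π.∑ nonzeros (x ⊗_)                        ≡⟨ *Π.∑-cong nonzeros (*-comm x) ⟩
        *Π.∑ nonzeros (_⊗ x)                        ≡⟨ *Π.∑-map nonzeros (_⊗ x) (λ y → y) ⟨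
        *Π.∑ (map (_⊗ x) nonzeros) (λ y → y)        ≡⟨ *Π.∑-↭ (λ y → y) (scale-nonzeros-↭ x≢0) ⟩
        ∏                                           ≡⟨ *-identityˡ ∏ ⟨
        1# ⊗ ∏                                      ∎)

  module Trace {p r : ℕ} (p-prime : Prime p) (q≡pʳ : q ≡ p ℕ.^ r) where
    open Frobenius p-prime (q≡pʳ⇒p×1≡0 p r q≡pʳ)

    private
      pˢ<pˢ⁺¹ : ∀ s → p ℕ.^ s < p ℕ.^ suc s
      pˢ<pˢ⁺¹ s = ℕP.^-monoʳ-< p (ℕ.nonTrivial⇒n>1 p {{prime⇒nonTrivial p-prime}}) (ℕP.n<1+n s)

    Tr : Carrier → Carrier
    Tr x = +Σ.∑ (upTo r) (λ j → x ^ (p ℕ.^ j))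

    trace≡Tr : ∀ x → trace F p r x ≡ Tr x
    trace≡Tr x = +Σ.∑-cong (upTo r) (λ j → fpow≡^ x (p ℕ.^ j))

    Tr-⊕ : ∀ x y → Tr (x ⊕ y) ≡ Tr x ⊕ Tr y
    Tr-⊕ x y = trans (+Σ.∑-cong (upTo r) (λ j → frobenius-^ j x y)) (+Σ.∑-∙ (upTo r) _ _)

    -- coefficients below the leading 1 of X^(p^s) + ... + X^p + X
    traceCoeffs : ℕ → List Carrier
    traceCoeffs zero    = 0# ∷ []
    traceCoeffs (suc s) = replicate (p ℕ.^ suc s ∸ suc (p ℕ.^ s)) 0# ++ 1# ∷ traceCoeffs s

    length-traceCoeffs : ∀ s → length (traceCoeffs s) ≡ p ℕ.^ s
    length-traceCoeffs zero    = refl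
    length-traceCoeffs (suc s) = begin
      length (replicate m 0# ++ 1# ∷ traceCoeffs s)  ≡⟨ ListP.length-++ (replicate m 0#) ⟩
      length (replicate m 0#) + suc (length (traceCoeffs s))
        ≡⟨ cong₂ (λ a b → a + suc b) (ListP.length-replicate m) (length-traceCoeffs s) ⟩
      m + suc (p ℕ.^ s)                               ≡⟨ ℕP.m∸n+n≡m (pˢ<pˢ⁺¹ s) ⟩
      p ℕ.^ suc s                                     ∎
      where m = p ℕ.^ suc s ∸ suc (p ℕ.^ s)

    horner-zeros : ∀ c m x → horner c (replicate m 0#) x ≡ c ⊗ x ^ m
    horner-zeros c zero    x = sym (*-identityʳ c)
    horner-zeros c (suc m) x = begin
      horner (c ⊗ x ⊕ 0#) (replicate m 0#) x ≡⟨ horner-zeros (c ⊗ x ⊕ 0#) m x ⟩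
      (c ⊗ x ⊕ 0#) ⊗ x ^ m                  ≡⟨ cong (_⊗ x ^ m) (+-identityʳ _) ⟩
      (c ⊗ x) ⊗ x ^ m                       ≡⟨ *-assoc c x _ ⟩
      c ⊗ x ^ suc m                         ∎

    horner-traceCoeffs : ∀ s x → horner 1# (traceCoeffs s) x ≡ +Σ.∑ (upTo (suc s)) (λ j → x ^ (p ℕ.^ j))
    horner-traceCoeffs zero    x = cong (_⊕ 0#) (trans (*-identityˡ x) (sym (*-identityʳ x)))
    horner-traceCoeffs (suc s) x = begin
      horner 1# (replicate m 0# ++ 1# ∷ traceCoeffs s) x
        ≡⟨ ListP.foldl-++ _ 1# (replicate m 0#) (1# ∷ traceCoeffs s) ⟩
      horner (horner 1# (replicate m 0#) x) (1# ∷ traceCoeffs s) x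
        ≡⟨ cong (λ c → horner c (1# ∷ traceCoeffs s) x) (trans (horner-zeros 1# m x) (*-identityˡ _)) ⟩
      horner (x ^ m) (1# ∷ traceCoeffs s) x
        ≡⟨ horner-leading (x ^ m) (1# ∷ traceCoeffs s) x ⟩
      x ^ m ⊗ x ^ suc (length (traceCoeffs s)) ⊕ horner 0# (1# ∷ traceCoeffs s) x
        ≡⟨ cong₂ _⊕_ (trans (sym (^-homo-* x m _)) (cong (x ^_) m+[1+pˢ]≡pˢ⁺¹)) (horner-0∷ 1# (traceCoeffs s) x) ⟩
      x ^ (p ℕ.^ suc s) ⊕ horner 1# (traceCoeffs s) x
        ≡⟨ cong (x ^ (p ℕ.^ suc s) ⊕_) (horner-traceCoeffs s x) ⟩
      x ^ (p ℕ.^ suc s) ⊕ +Σ.∑ (upTo (suc s)) (λ j → x ^ (p ℕ.^ j))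
        ≡⟨ +-comm _ _ ⟩
      +Σ.∑ (upTo (suc s)) (λ j → x ^ (p ℕ.^ j)) ⊕ x ^ (p ℕ.^ suc s)
        ≡⟨ +Σ.∑-upTo-last (suc s) (λ j → x ^ (p ℕ.^ j)) ⟨
      +Σ.∑ (upTo (suc (suc s))) (λ j → x ^ (p ℕ.^ j)) ∎
      where
        m = p ℕ.^ suc s ∸ suc (p ℕ.^ s)
        m+[1+pˢ]≡pˢ⁺¹ : m + suc (length (traceCoeffs s)) ≡ p ℕ.^ suc s
        m+[1+pˢ]≡pˢ⁺¹ = trans (cong (λ n → m + suc n) (length-traceCoeffs s))
                               (ℕP.m∸n+n≡m (pˢ<pˢ⁺¹ s))

    Tr-not-identically-0 : 1 ≤ r → ∃ λ y → Tr y ≢ 0#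
    Tr-not-identically-0 1≤r with all? (λ y → Tr y ≟ 0#) elements
    ... | no ¬all0 = Any.satisfied (¬All⇒Any¬ (λ y → Tr y ≟ 0#) elements ¬all0)
    ... | yes all0 = contradiction q≤pˢ (ℕP.<⇒≱ (subst (p ℕ.^ s <_) (sym q≡pˢ⁺¹) (pˢ<pˢ⁺¹ s)))
      where
        s : ℕ
        s = ℕ.pred r
        r≡1+s : r ≡ suc s
        r≡1+s = sym (ℕP.suc-pred r {{ℕ.>-nonZero 1≤r}})
        q≡pˢ⁺¹ : q ≡ p ℕ.^ suc s
        q≡pˢ⁺¹ = trans q≡pʳ (cong (p ℕ.^_) r≡1+s)
        q≤pˢ : q ≤ p ℕ.^ s
        q≤pˢ = subst (q ≤_) (length-traceCoeffs s) (roots≤degree (traceCoeffs s) 1≢0 unique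
                 (All.map (λ {y} Tr≡0 → trans (horner-traceCoeffs s y)
                    (trans (cong (λ n → +Σ.∑ (upTo n) (λ j → y ^ (p ℕ.^ j))) (sym r≡1+s)) Tr≡0)) all0))

    Tr-^p : ∀ y → Tr y ^ p ≡ Tr y
    Tr-^p y = RP.+-cancelˡ y _ _ (begin
      y ⊕ Tr y ^ p                                       ≡⟨ cong (y ⊕_) (+Σ.∑-hom (_^ p) 0^p≡0 frobenius (upTo r) _) ⟩
      y ⊕ +Σ.∑ (upTo r) (λ j → (y ^ (p ℕ.^ j)) ^ p)      ≡⟨ cong₂ _⊕_ (sym (*-identityʳ y)) (+Σ.∑-cong (upTo r) ^pʲ⁺¹) ⟩
      y ^ 1 ⊕ +Σ.∑ (upTo r) (λ j → y ^ (p ℕ.^ suc j))    ≡⟨ +Σ.∑-upTo-suc r (λ j → y ^ (p ℕ.^ j)) ⟨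
      +Σ.∑ (upTo (suc r)) (λ j → y ^ (p ℕ.^ j))          ≡⟨ +Σ.∑-upTo-last r (λ j → y ^ (p ℕ.^ j)) ⟩
      Tr y ⊕ y ^ (p ℕ.^ r)                               ≡⟨ cong (λ n → Tr y ⊕ y ^ n) (sym q≡pʳ) ⟩
      Tr y ⊕ y ^ q                                       ≡⟨ cong (Tr y ⊕_) (fermat y) ⟩
      Tr y ⊕ y                                           ≡⟨ +-comm _ y ⟩
      y ⊕ Tr y                                           ∎)
      where
        0^p≡0 : 0# ^ p ≡ 0#
        0^p≡0 = subst (λ n → 0# ^ n ≡ 0#) (ℕP.suc-pred p {{prime⇒nonZero p-prime}}) (zeroˡ _)
        ^pʲ⁺¹ : ∀ j → (y ^ (p ℕ.^ j)) ^ p ≡ y ^ (p ℕ.^ suc j)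
        ^pʲ⁺¹ j = trans (^-assocʳ y (p ℕ.^ j) p) (cong (y ^_) (ℕP.*-comm (p ℕ.^ j) p))

    Tr-onto-1 : 1 ≤ r → ∃ λ y → Tr y ≡ 1#
    Tr-onto-1 1≤r with Tr-not-identically-0 1≤r
    ... | y , Tr≢0 with inverse (Tr y) Tr≢0
    ...   | v , Tr·v≡1 = y ⊗ v , (begin
      Tr (y ⊗ v)                             ≡⟨ +Σ.∑-cong (upTo r) (λ j → trans (^-distrib-* y v (p ℕ.^ j)) (cong (y ^ (p ℕ.^ j) ⊗_) (v^pʲ≡v j))) ⟩
      +Σ.∑ (upTo r) (λ j → y ^ (p ℕ.^ j) ⊗ v) ≡⟨ +Σ.∑-hom (_⊗ v) (zeroˡ v) (λ a b → distribʳ v a b) (upTo r) _ ⟨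
      Tr y ⊗ v                               ≡⟨ Tr·v≡1 ⟩
      1#                                     ∎)
      where
        -- v = (Tr y)⁻¹ lies in the prime field because Tr y does
        v^p≡v : v ^ p ≡ v
        v^p≡v = ⊗-cancelʳ Tr≢0 (begin
          v ^ p ⊗ Tr y         ≡⟨ cong (v ^ p ⊗_) (Tr-^p y) ⟨
          v ^ p ⊗ Tr y ^ p     ≡⟨ ^-distrib-* v (Tr y) p ⟨
          (v ⊗ Tr y) ^ p       ≡⟨ cong (_^ p) (trans (*-comm v (Tr y)) Tr·v≡1) ⟩
          1# ^ p               ≡⟨ 1^n≡1 p ⟩
          1#                   ≡⟨ trans (sym Tr·v≡1) (*-comm (Tr y) v) ⟩
          v ⊗ Tr y             ∎)
          where
            1^n≡1 : ∀ n → 1# ^ n ≡ 1#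
            1^n≡1 zero    = refl
            1^n≡1 (suc n) = trans (*-identityˡ _) (1^n≡1 n)
        v^pʲ≡v : ∀ j → v ^ (p ℕ.^ j) ≡ v
        v^pʲ≡v zero    = *-identityʳ v
        v^pʲ≡v (suc j) = begin
          v ^ (p ℕ.* p ℕ.^ j)   ≡⟨ cong (v ^_) (ℕP.*-comm p (p ℕ.^ j)) ⟩
          v ^ (p ℕ.^ j ℕ.* p)   ≡⟨ ^-assocʳ v (p ℕ.^ j) p ⟨
          (v ^ (p ℕ.^ j)) ^ p   ≡⟨ cong (_^ p) (v^pʲ≡v j) ⟩
          v ^ p                 ≡⟨ v^p≡v ⟩
          v                     ∎

    traceCount : Carrier → ℕ
    traceCount v = ℕΣ.∑ elements (λ c → 𝟙 (trace F p r c ≟ v))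

    traceCount-natF : 1 ≤ r → ∀ i → traceCount (natF F i) ≡ traceCount 0#
    traceCount-natF 1≤r zero    = refl
    traceCount-natF 1≤r (suc i) = trans (traceCount-1⊕ (natF F i)) (traceCount-natF 1≤r i)
      where
        y : Carrier
        y = proj₁ (Tr-onto-1 1≤r)
        trace-⊕y : ∀ c → trace F p r (c ⊕ y) ≡ 1# ⊕ trace F p r c
        trace-⊕y c = begin
          trace F p r (c ⊕ y)  ≡⟨ trans (trace≡Tr (c ⊕ y)) (Tr-⊕ c y) ⟩
          Tr c ⊕ Tr y          ≡⟨ cong₂ _⊕_ (sym (trace≡Tr c)) (proj₂ (Tr-onto-1 1≤r)) ⟩
          trace F p r c ⊕ 1#   ≡⟨ +-comm _ 1# ⟩
          1# ⊕ trace F p r c   ∎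
        traceCount-1⊕ : ∀ v → traceCount (1# ⊕ v) ≡ traceCount v
        traceCount-1⊕ v = begin
          traceCount (1# ⊕ v)                                          ≡⟨ ℕΣ.∑-↭ _ (translate-↭ y) ⟨
          ℕΣ.∑ (map (_⊕ y) elements) (λ c → 𝟙 (trace F p r c ≟ (1# ⊕ v))) ≡⟨ ℕΣ.∑-map elements (_⊕ y) _ ⟩
          ℕΣ.∑ elements (λ c → 𝟙 (trace F p r (c ⊕ y) ≟ (1# ⊕ v)))       ≡⟨ ℕΣ.∑-cong elements shifted ⟩
          traceCount v                                                 ∎
          where
            shifted : ∀ c → 𝟙 (trace F p r (c ⊕ y) ≟ (1# ⊕ v)) ≡ 𝟙 (trace F p r c ≟ v)
            shifted c = 𝟙-cong _ _ (λ eq → RP.+-cancelˡ 1# _ _ (trans (sym (trace-⊕y c)) eq))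
                                   (λ eq → trans (trace-⊕y c) (cong (1# ⊕_) eq))

open import Data.Nat using (_^_)

module PointCounting (F : FiniteField) where
  open FiniteField F renaming (_+_ to _⊕_; _*_ to _⊗_; -_ to ⊖_)
  open FiniteFieldProperties F
  open IsCommutativeRing isCommutativeRing using (+-identityˡ; zeroˡ; zeroʳ)
  open ≡-Reasoning

  ∑ᵖ : ℕ → (List Carrier → ℕ) → ℕ
  ∑ᵖ m f = ℕΣ.∑ (points F m) f

  ∑ᵖ-suc : ∀ m f → ∑ᵖ (suc m) f ≡ ℕΣ.∑ elements (λ x → ∑ᵖ m (f ∘ (x ∷_)))
  ∑ᵖ-suc m f = trans (ℕΣ.∑-concatMap elements (λ x → map (x ∷_) (points F m)) f)
                     (ℕΣ.∑-cong elements (λ x → ℕΣ.∑-map (points F m) (x ∷_) f))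

  points-length : ∀ m → All (λ ys → length ys ≡ m) (points F m)
  points-length zero    = refl ∷ []
  points-length (suc m) =
    AllP.concat⁺ (AllP.map⁺ (All.universal (λ x → AllP.map⁺ (All.map (cong suc) (points-length m))) elements))

  ∑ᵖ-cong : ∀ m {f g} → (∀ ys → length ys ≡ m → f ys ≡ g ys) → ∑ᵖ m f ≡ ∑ᵖ m g
  ∑ᵖ-cong m f≗g = ℕΣ.∑-congᴬ (All.map (f≗g _) (points-length m))

  prefix∏ : ℕ → List Carrier → Carrier
  prefix∏ j ys = fprod F (take j ys)

  T : ℕ → List Carrier → Carrier
  T = evalT F

  T-cons : ∀ k x ys → k ≤ length ys → T k (x ∷ ys) ≡ prefix∏ k (x ∷ ys) ⊕ T k ys
  T-cons k x ys k≤ = trans (cong (λ n → +Σ.∑ (upTo (suc n)) window) (ℕP.+-∸-assoc 1 k≤))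
                           (+Σ.∑-upTo-suc (suc (length ys ∸ k)) window)
    where window = λ i → prefix∏ k (drop i (x ∷ ys))

  prefix∏-≡0 : ∀ {j j′} ys → j ≤ j′ → prefix∏ j ys ≡ 0# → prefix∏ j′ ys ≡ 0#
  prefix∏-≡0 {zero}          ys       _         1≡0 = contradiction 1≡0 1≢0
  prefix∏-≡0 {suc j} {suc j′} []       _         1≡0 = contradiction 1≡0 1≢0
  prefix∏-≡0 {suc j} {suc j′} (y ∷ ys) (s≤s j≤j′) yΠ≡0 with ⊗≡0⇒ y _ yΠ≡0
  ... | inj₁ y≡0 = trans (cong (_⊗ _) y≡0) (zeroˡ _)
  ... | inj₂ Π≡0 = trans (cong (y ⊗_) (prefix∏-≡0 ys j≤j′ Π≡0)) (zeroʳ y)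

  module WeightedCount (k′ : ℕ) (w : Carrier → ℕ) where
    private
      k : ℕ
      k = suc k′

    N : ℕ → ℕ
    N m = ∑ᵖ m (w ∘ T k)

    W : ℕ
    W = ℕΣ.∑ elements w

    B : ℕ → ℕ
    B m = ∑ᵖ m (λ ys → 𝟙 (¬? (prefix∏ k′ ys ≟ 0#)))

    Z : ℕ → ℕ → ℕ
    Z j m = ∑ᵖ m (λ ys → 𝟙 (prefix∏ j ys ≟ 0#) * w (T k ys))

    ∑-affine : ∀ u c → ℕΣ.∑ elements (λ x → w (x ⊗ u ⊕ c)) ≡ q * (𝟙 (u ≟ 0#) * w c) + W * 𝟙 (¬? (u ≟ 0#))
    ∑-affine u c with u ≟ 0#
    ... | yes refl = begin
      ℕΣ.∑ elements (λ x → w (x ⊗ 0# ⊕ c)) ≡⟨ ℕΣ.∑-cong elements (λ x → cong (λ t → w (t ⊕ c)) (zeroʳ x)) ⟩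
      ℕΣ.∑ elements (λ _ → w (0# ⊕ c))     ≡⟨ ∑-const elements _ (w c) (All.universal (λ _ → cong w (+-identityˡ c)) elements) ⟩
      q * w c                              ≡⟨ arith q (w c) W ⟩
      q * (1 * w c) + W * 0                ∎
      where
        arith : ∀ a b c → a * b ≡ a * (1 * b) + c * 0
        arith = solve-∀
    ... | no u≢0 = begin
      ℕΣ.∑ elements (λ x → w (x ⊗ u ⊕ c))  ≡⟨ ℕΣ.∑-map elements (_⊗ u) (λ y → w (y ⊕ c)) ⟨
      ℕΣ.∑ (map (_⊗ u) elements) (λ y → w (y ⊕ c)) ≡⟨ ℕΣ.∑-↭ _ (scale-↭ u≢0) ⟩
      ℕΣ.∑ elements (λ y → w (y ⊕ c))      ≡⟨ ℕΣ.∑-map elements (_⊕ c) w ⟨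
      ℕΣ.∑ (map (_⊕ c) elements) w         ≡⟨ ℕΣ.∑-↭ w (translate-↭ c) ⟩
      W                                    ≡⟨ arith′ q (w c) W ⟩
      q * (0 * w c) + W * 1                ∎
      where
        arith′ : ∀ a b c → c ≡ a * (0 * b) + c * 1
        arith′ = solve-∀

    N-suc : ∀ m → k ≤ m → N (suc m) ≡ q * Z k′ m + W * B m
    N-suc m k≤m = begin
      N (suc m)
        ≡⟨ ∑ᵖ-suc m (w ∘ T k) ⟩
      ℕΣ.∑ elements (λ x → ∑ᵖ m (λ ys → w (T k (x ∷ ys))))
        ≡⟨ ℕΣ.∑-cong elements (λ x → ∑ᵖ-cong m (λ ys |ys|≡m →
             cong w (T-cons k x ys (subst (k ≤_) (sym |ys|≡m) k≤m)))) ⟩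
      ℕΣ.∑ elements (λ x → ∑ᵖ m (λ ys → w (x ⊗ prefix∏ k′ ys ⊕ T k ys)))
        ≡⟨ ℕΣ.∑-swap elements (points F m) (λ x ys → w (x ⊗ prefix∏ k′ ys ⊕ T k ys)) ⟩
      ∑ᵖ m (λ ys → ℕΣ.∑ elements (λ x → w (x ⊗ prefix∏ k′ ys ⊕ T k ys)))
        ≡⟨ ℕΣ.∑-cong (points F m) (λ ys → ∑-affine (prefix∏ k′ ys) (T k ys)) ⟩
      ∑ᵖ m (λ ys → q * (𝟙 (prefix∏ k′ ys ≟ 0#) * w (T k ys)) + W * 𝟙 (¬? (prefix∏ k′ ys ≟ 0#)))
        ≡⟨ ℕΣ.∑-∙ (points F m) _ _ ⟩
      ∑ᵖ m (λ ys → q * (𝟙 (prefix∏ k′ ys ≟ 0#) * w (T k ys))) + ∑ᵖ m (λ ys → W * 𝟙 (¬? (prefix∏ k′ ys ≟ 0#)))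
        ≡⟨ cong₂ _+_ (∑-*ˡ q (points F m) _) (∑-*ˡ W (points F m) _) ⟩
      q * Z k′ m + W * B m ∎

    Z-zero : ∀ m → Z 0 m ≡ 0
    Z-zero m = trans (ℕΣ.∑-cong (points F m) (λ ys → cong (_* w (T k ys)) (𝟙-no (1# ≟ 0#) 1≢0)))
                     (ℕΣ.∑-ε (points F m))

    Z-suc : ∀ j m → j < k′ → k ≤ m → Z (suc j) (suc m) ≡ N m + (q ∸ 1) * Z j m
    Z-suc j m j<k′ k≤m = begin
      Z (suc j) (suc m)
        ≡⟨ ∑ᵖ-suc m _ ⟩
      ℕΣ.∑ elements (λ y → ∑ᵖ m (λ ys → 𝟙 ((y ⊗ prefix∏ j ys) ≟ 0#) * w (T k (y ∷ ys))))
        ≡⟨ ∑-split0 _ (Z j m) (λ y y≢0 → ∑ᵖ-cong m (λ ys |ys|≡m → at-nonzero y≢0 ys (T-cons′ y ys |ys|≡m))) ⟩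
      ∑ᵖ m (λ ys → 𝟙 ((0# ⊗ prefix∏ j ys) ≟ 0#) * w (T k (0# ∷ ys))) + (q ∸ 1) * Z j m
        ≡⟨ cong (_+ (q ∸ 1) * Z j m) (∑ᵖ-cong m (λ ys |ys|≡m → at-zero ys (T-cons′ 0# ys |ys|≡m))) ⟩
      N m + (q ∸ 1) * Z j m ∎
      where
        T-cons′ : ∀ y ys → length ys ≡ m → T k (y ∷ ys) ≡ y ⊗ prefix∏ k′ ys ⊕ T k ys
        T-cons′ y ys |ys|≡m = T-cons k y ys (subst (k ≤_) (sym |ys|≡m) k≤m)
        at-zero : ∀ ys → T k (0# ∷ ys) ≡ 0# ⊗ prefix∏ k′ ys ⊕ T k ys →
                  𝟙 ((0# ⊗ prefix∏ j ys) ≟ 0#) * w (T k (0# ∷ ys)) ≡ w (T k ys)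
        at-zero ys T≡ = begin
          𝟙 ((0# ⊗ prefix∏ j ys) ≟ 0#) * w (T k (0# ∷ ys)) ≡⟨ cong (_* w (T k (0# ∷ ys))) (𝟙-yes ((0# ⊗ prefix∏ j ys) ≟ 0#) (zeroˡ (prefix∏ j ys))) ⟩
          1 * w (T k (0# ∷ ys))                 ≡⟨ ℕP.*-identityˡ _ ⟩
          w (T k (0# ∷ ys))                     ≡⟨ cong w (trans T≡ (trans (cong (_⊕ T k ys) (zeroˡ _)) (+-identityˡ _))) ⟩
          w (T k ys)                            ∎
        at-nonzero : ∀ {y} → y ≢ 0# → ∀ ys → T k (y ∷ ys) ≡ y ⊗ prefix∏ k′ ys ⊕ T k ys →
                     𝟙 ((y ⊗ prefix∏ j ys) ≟ 0#) * w (T k (y ∷ ys)) ≡ 𝟙 (prefix∏ j ys ≟ 0#) * w (T k ys)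
        at-nonzero {y} y≢0 ys T≡ with prefix∏ j ys ≟ 0#
        ... | no Π≢0  = cong (_* w (T k (y ∷ ys))) (𝟙-no ((y ⊗ prefix∏ j ys) ≟ 0#) (⊗-≢0 y≢0 Π≢0))
        ... | yes Π≡0 = cong₂ _*_
          (𝟙-yes ((y ⊗ prefix∏ j ys) ≟ 0#) (trans (cong (y ⊗_) Π≡0) (zeroʳ y)))
          (cong w (begin
            T k (y ∷ ys)                         ≡⟨ T≡ ⟩
            y ⊗ prefix∏ k′ ys ⊕ T k ys    ≡⟨ cong (λ t → y ⊗ t ⊕ T k ys) (prefix∏-≡0 ys (ℕP.<⇒≤ j<k′) Π≡0) ⟩
            y ⊗ 0# ⊕ T k ys                      ≡⟨ cong (_⊕ T k ys) (zeroʳ y) ⟩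
            0# ⊕ T k ys                          ≡⟨ +-identityˡ _ ⟩
            T k ys                               ∎))

    Z-closed : ∀ j m → j ≤ k′ → j + k ≤ m → Z j m ≡ ℕΣ.∑ (upTo j) (λ i → (q ∸ 1) ^ i * N (m ∸ suc i))
    Z-closed zero    m       _    _             = Z-zero m
    Z-closed (suc j) (suc m) j<k′ (s≤s j+k≤m) = begin
      Z (suc j) (suc m)
        ≡⟨ Z-suc j m j<k′ (ℕP.≤-trans (ℕP.m≤n+m k j) j+k≤m) ⟩
      N m + (q ∸ 1) * Z j m
        ≡⟨ cong (λ z → N m + (q ∸ 1) * z) (Z-closed j m (ℕP.<⇒≤ j<k′) j+k≤m) ⟩
      N m + (q ∸ 1) * ℕΣ.∑ (upTo j) (λ i → (q ∸ 1) ^ i * N (m ∸ suc i))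
        ≡⟨ cong₂ _+_ (sym (ℕP.*-identityˡ (N m))) (sym (∑-*ˡ (q ∸ 1) (upTo j) _)) ⟩
      1 * N m + ℕΣ.∑ (upTo j) (λ i → (q ∸ 1) * ((q ∸ 1) ^ i * N (m ∸ suc i)))
        ≡⟨ cong (1 * N m +_) (ℕΣ.∑-cong (upTo j) (λ i → sym (ℕP.*-assoc (q ∸ 1) _ _))) ⟩
      1 * N m + ℕΣ.∑ (upTo j) (λ i → (q ∸ 1) ^ suc i * N (m ∸ suc i))
        ≡⟨ ℕΣ.∑-upTo-suc j (λ i → (q ∸ 1) ^ i * N (suc m ∸ suc i)) ⟨
      ℕΣ.∑ (upTo (suc j)) (λ i → (q ∸ 1) ^ i * N (suc m ∸ suc i)) ∎

    N-recurrence : ∀ m → k + k ≤ suc m →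
                   N (suc m) ≡ q * ℕΣ.∑ (upTo k′) (λ i → (q ∸ 1) ^ i * N (m ∸ suc i)) + W * B m
    N-recurrence m (s≤s k′+k≤m) = begin
      N (suc m)                  ≡⟨ N-suc m (ℕP.≤-trans (ℕP.m≤n+m k k′) k′+k≤m) ⟩
      q * Z k′ m + W * B m       ≡⟨ cong (λ z → q * z + W * B m) (Z-closed k′ m ℕP.≤-refl k′+k≤m) ⟩
      q * ℕΣ.∑ (upTo k′) (λ i → (q ∸ 1) ^ i * N (m ∸ suc i)) + W * B m ∎

module ℤΣ = Sum ℤP.+-0-isCommutativeMonoid

recRHS-pos : ∀ {p} q k′ m (u : ℕ → Fin p → ℤ) (c : ℕ → ℕ) a → (∀ i → u i a ≡ ℤ.+ c i) →
             recRHS q (suc k′) (suc m) u a ≡ ℤ.+ (q * ℕΣ.∑ (upTo k′) (λ i → (q ∸ 1) ^ i * c (m ∸ suc i)))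
recRHS-pos q k′ m u c a u≡c = begin
  recRHS q (suc k′) (suc m) u a
    ≡⟨ ℤΣ.∑-upTo-suc k′ (λ j → recCoeff q (suc j) ℤ.* u (suc m ∸ suc j) a) ⟩
  ℤ.+ 0 ℤ.* u m a ℤ.+ ℤΣ.∑ (upTo k′) (λ i → ℤ.+ (q * (q ∸ 1) ^ i) ℤ.* u (m ∸ suc i) a)
    ≡⟨ trans (cong (ℤ._+ rest) (ℤP.*-zeroˡ (u m a))) (ℤP.+-identityˡ rest) ⟩
  ℤΣ.∑ (upTo k′) (λ i → ℤ.+ (q * (q ∸ 1) ^ i) ℤ.* u (m ∸ suc i) a)
    ≡⟨ ℤΣ.∑-cong (upTo k′) (λ i → trans (cong (ℤ.+ (q * (q ∸ 1) ^ i) ℤ.*_) (u≡c (m ∸ suc i)))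
                                        (sym (ℤP.pos-* (q * (q ∸ 1) ^ i) (c (m ∸ suc i))))) ⟩
  ℤΣ.∑ (upTo k′) (λ i → ℤ.+ (q * (q ∸ 1) ^ i * c (m ∸ suc i)))
    ≡⟨ ℤΣ.∑-hom ℤ.+_ refl ℤP.pos-+ (upTo k′) _ ⟨
  ℤ.+ ℕΣ.∑ (upTo k′) (λ i → q * (q ∸ 1) ^ i * c (m ∸ suc i))
    ≡⟨ cong ℤ.+_ (trans (ℕΣ.∑-cong (upTo k′) (λ i → ℕP.*-assoc q _ _)) (∑-*ˡ q (upTo k′) _)) ⟩
  ℤ.+ (q * ℕΣ.∑ (upTo k′) (λ i → (q ∸ 1) ^ i * c (m ∸ suc i))) ∎
  where
    open ≡-Reasoning
    rest : ℤ
    rest = ℤΣ.∑ (upTo k′) (λ i → ℤ.+ (q * (q ∸ 1) ^ i) ℤ.* u (m ∸ suc i) a)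

module ExpSumDefect (F : FiniteField) {p r : ℕ} (k′ : ℕ) where
  open FiniteField F using (_≟_)
  open FiniteFieldProperties F using (q)
  open PointCounting F using (module WeightedCount)

  module Count (a : Fin p) = WeightedCount k′ (λ c → 𝟙 (trace F p r c ≟ natF F (toℕ a)))

  u : ℕ → Fin p → ℤ
  u = expSumT F p r (suc k′)

  u≡N : ∀ n a → u n a ≡ ℤ.+ Count.N a n
  u≡N n a = cong ℤ.+_ (length-filter≡∑𝟙 _ (points F n))

  recurrence-defect : ∀ m a → suc k′ + suc k′ ≤ suc m → u (suc m) a ℤ.- recRHS q (suc k′) (suc m) u a ≡ ℤ.+ (Count.W a * Count.B a m)
  recurrence-defect m a 2k≤n = begin
    u (suc m) a ℤ.- recRHS q (suc k′) (suc m) u a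
      ≡⟨ cong₂ ℤ._-_ (trans (u≡N (suc m) a) (cong ℤ.+_ (Count.N-recurrence a m 2k≤n)))
                    (recRHS-pos q k′ m u (Count.N a) a (λ i → u≡N i a)) ⟩
    ℤ.+ (X + Count.W a * Count.B a m) ℤ.- ℤ.+ X
      ≡⟨ cong (ℤ._- ℤ.+ X) (ℤP.pos-+ X _) ⟩
    (ℤ.+ X ℤ.+ ℤ.+ (Count.W a * Count.B a m)) ℤ.- ℤ.+ X
      ≡⟨ [x+y]-x≡y (ℤ.+ X) _ ⟩
    ℤ.+ (Count.W a * Count.B a m) ∎
    where
      open ≡-Reasoning
      X : ℕ
      X = q * ℕΣ.∑ (upTo k′) (λ i → (q ∸ 1) ^ i * Count.N a (m ∸ suc i))
      [x+y]-x≡y : ∀ x y → (x ℤ.+ y) ℤ.- x ≡ y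
      [x+y]-x≡y = ℤSolver.solve-∀

theorem3p2 : (k : ℕ) → 2 ≤ k → (p r : ℕ) → Prime p → 1 ≤ r →
    (F : FiniteField) → length (FiniteField.elements F) ≡ p ^ r →
    (n : ℕ) → 2 * k ≤ n →
    expSumT F p r k n ≈ζ recRHS (p ^ r) k n (expSumT F p r k)
theorem3p2 (suc k′) _ p r p-prime 1≤r F q≡pʳ (suc m) 2k≤n a b rewrite sym q≡pʳ = begin
  u (suc m) a ℤ.- recRHS q (suc k′) (suc m) u a ≡⟨ recurrence-defect m a k+k≤n ⟩
  ℤ.+ (Count.W a * Count.B a m)                 ≡⟨ cong (λ w → ℤ.+ (w * Count.B a m)) W-constant ⟩
  ℤ.+ (Count.W b * Count.B b m)                 ≡⟨ recurrence-defect m b k+k≤n ⟨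
  u (suc m) b ℤ.- recRHS q (suc k′) (suc m) u b ∎
  where
    open ≡-Reasoning
    open ExpSumDefect F {p} {r} k′
    open FiniteFieldProperties F using (q)
    open FrobeniusAndTrace.Trace F {p} {r} p-prime q≡pʳ using (traceCount-natF)
    k+k≤n : suc k′ + suc k′ ≤ suc m
    k+k≤n = subst (λ j → suc k′ + j ≤ suc m) (ℕP.+-identityʳ (suc k′)) 2k≤n
    W-constant : Count.W a ≡ Count.W b
    W-constant = trans (traceCount-natF 1≤r (toℕ a)) (sym (traceCount-natF 1≤r (toℕ b)))
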